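{- Let $C$ be a $\mathcal{SHIQ}$-concept in negation normal form, $\mathcal{R}$ a role hierarchy, and $\cdot^{\mathit{tr}}$ and $\mathcal{T}_C$ as defined below. Then $C$ is satisfiable w.r.t. $\mathcal{R}$ iff the $\mathcal{ALCQI}b$-concept $C^{\mathit{tr}}$ is satisfiable w.r.t. the general TBox $\mathcal{T}_C$.
   Context: $\mathcal{SHIQ}$ is $\mathcal{ALC}$ extended with transitive roles, inverse roles, role hierarchies and qualifying number restrictions $(\bowtie n\, S\, D)$ (for $\bowtie\in\{\leq,\geq\}$) over simple roles $S$; interpretations must interpret transitive role names by transitive relations and satisfy every role inclusion $R\sqsubseteq S$ of the role hierarchy $\mathcal{R}$. $\mathcal{ALCQI}b$ is $\mathcal{ALC}$ with qualifying number restrictions over safe Boolean role expressions built from (possibly inverse) roles, in particular role conjunctions. For a role $R$, $\mathsf{Inv}(R)$ is its inverse, $\mathsf{Trans}(R)$ holds iff $R$ or $\mathsf{Inv}(R)$ is a transitive role name, and $\sqsubseteq^*$ is the reflexive-transitive closure of $\mathcal{R}\cup\{\mathsf{Inv}(R)\sqsubseteq\mathsf{Inv}(S)\mid R\sqsubseteq S\in\mathcal{R}\}$; $\mathcal{R}$ is assumed cycle-free. For a role $R$, ${R^\uparrow}$ denotes the role conjunction of all roles $S$ with $R\sqsubseteq^* S$. $\mathopen{\sim}D$ denotes the negation normal form of $\neg D$. $\mathit{clos}(C,\mathcal{R})$ is the smallest set of concepts containing $C$, closed under sub-concepts and $\mathopen{\sim}$, and such that if $\forall R.D$ is in it and $T\sqsubseteq^*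 R$ with $\mathsf{Trans}(T)$, then $\forall T.D$ is in it. For every $\forall R.D\in\mathit{clos}(C,\mathcal{R})$ let $X_{R,D}$ be a fresh concept name not occurring in $C$. The map $\cdot^{\mathit{tr}}$ is defined inductively on concepts in NNF by $A^{\mathit{tr}}=A$, $(\neg A)^{\mathit{tr}}=\neg A$ for concept names $A$, $(C_1\sqcap C_2)^{\mathit{tr}}=C_1^{\mathit{tr}}\sqcap C_2^{\mathit{tr}}$, $(C_1\sqcup C_2)^{\mathit{tr}}=C_1^{\mathit{tr}}\sqcup C_2^{\mathit{tr}}$, $(\bowtie n\, R\, D)^{\mathit{tr}}=(\bowtie n\, {R^\uparrow}\, D^{\mathit{tr}})$, $(\forall R.D)^{\mathit{tr}}=X_{R,D}$, $(\exists R.D)^{\mathit{tr}}=\neg X_{R,\mathopen{\sim}D}$. The TBox $\mathcal{T}_C$ consists of the axioms $X_{R,D}\doteq\forall {R^\uparrow}.D^{\mathit{tr}}$ for every $\forall R.D\in\mathit{clos}(C,\mathcal{R})$, together with, for every $\forall R.D\in\mathit{clos}(C,\mathcal{R})$, the axiom stating that $X_{R,D}$ is subsumed by the conjunction (with $\sqcap$) of the concepts $\forall {T^\uparrow}.X_{T,D}$ over all roles $T$ with $T\sqsubseteq^* R$ and $\mathsf{Trans}(T)$. -}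

module Defs where

open import Level using (0ℓ)
open import Data.Nat using (ℕ; zero; suc)
open import Data.Fin using (Fin)
open import Data.List using (List)
open import Data.List.Membership.Propositional using (_∈_)
open import Data.Product using (Σ; _×_; _,_)
open import Data.Sum using (_⊎_; inj₁; inj₂)
open import Data.Empty using (⊥)
open import Data.Unit using (⊤)
open import Relation.Nullary using (¬_)
open import Relation.Binary.PropositionalEquality using (_≡_)

data Role : Set where
  rn  : ℕ → Role
  inv : ℕ → Role

Inv : Role → Role
Inv (rn n)  = inv n
Inv (inv n) = rn n

record RBox : Set where
  field
    incl  : List (Role × Role)
    trans : List ℕ
open RBox public

data _⊢_⊑*_ (ℛ : RBox) : Role → Role → Set where
  refl*   : ∀ {R} → ℛ ⊢ R ⊑* R
  step    : ∀ {R S T} → (R , S) ∈ incl ℛ → ℛ ⊢ S ⊑* T → ℛ ⊢ R ⊑* T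
  stepInv : ∀ {R S T} → (R , S) ∈ incl ℛ → ℛ ⊢ Inv S ⊑* T → ℛ ⊢ Inv R ⊑* T

Trans : RBox → Role → Set
Trans ℛ (rn n)  = n ∈ trans ℛ
Trans ℛ (inv n) = n ∈ trans ℛ

CycleFree : RBox → Set
CycleFree ℛ = ∀ R S → ℛ ⊢ R ⊑* S → ℛ ⊢ S ⊑* R → R ≡ S

Simple : RBox → Role → Set
Simple ℛ S = ∀ T → ℛ ⊢ T ⊑* S → ¬ Trans ℛ T

data Concept : Set where
  ⊤c ⊥c    : Concept
  atom     : ℕ → Concept
  natom    : ℕ → Concept
  _⊓_ _⊔_  : Concept → Concept → Concept
  all ex   : Role → Concept → Concept
  atLeast atMost : ℕ → Role → Concept → Concept

∼ : Concept → Concept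
∼ ⊤c = ⊥c
∼ ⊥c = ⊤c
∼ (atom A) = natom A
∼ (natom A) = atom A
∼ (C ⊓ D) = ∼ C ⊔ ∼ D
∼ (C ⊔ D) = ∼ C ⊓ ∼ D
∼ (all R D) = ex R (∼ D)
∼ (ex R D) = all R (∼ D)
∼ (atLeast zero R D) = ⊥c
∼ (atLeast (suc n) R D) = atMost n R D
∼ (atMost n R D) = atLeast (suc n) R D

data _◁_ : Concept → Concept → Set where
  ⊓l : ∀ {C D} → C ◁ (C ⊓ D)
  ⊓r : ∀ {C D} → D ◁ (C ⊓ D)
  ⊔l : ∀ {C D} → C ◁ (C ⊔ D)
  ⊔r : ∀ {C D} → D ◁ (C ⊔ D)
  ∀s : ∀ {R D} → D ◁ all R D
  ∃s : ∀ {R D} → D ◁ ex R D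
  ≥s : ∀ {n R D} → D ◁ atLeast n R D
  ≤s : ∀ {n R D} → D ◁ atMost n R D

data SHIQConcept (ℛ : RBox) : Concept → Set where
  ⊤w : SHIQConcept ℛ ⊤c
  ⊥w : SHIQConcept ℛ ⊥c
  atomw  : ∀ {A} → SHIQConcept ℛ (atom A)
  natomw : ∀ {A} → SHIQConcept ℛ (natom A)
  ⊓w : ∀ {C D} → SHIQConcept ℛ C → SHIQConcept ℛ D → SHIQConcept ℛ (C ⊓ D)
  ⊔w : ∀ {C D} → SHIQConcept ℛ C → SHIQConcept ℛ D → SHIQConcept ℛ (C ⊔ D)
  allw : ∀ {R D} → SHIQConcept ℛ D → SHIQConcept ℛ (all R D)
  exw  : ∀ {R D} → SHIQConcept ℛ D → SHIQConcept ℛ (ex R D)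
  atLeastw : ∀ {n S D} → Simple ℛ S → SHIQConcept ℛ D → SHIQConcept ℛ (atLeast n S D)
  atMostw  : ∀ {n S D} → Simple ℛ S → SHIQConcept ℛ D → SHIQConcept ℛ (atMost n S D)

data Clos (ℛ : RBox) (C : Concept) : Concept → Set where
  base  : Clos ℛ C C
  sub   : ∀ {D E} → Clos ℛ C E → D ◁ E → Clos ℛ C D
  neg   : ∀ {E} → Clos ℛ C E → Clos ℛ C (∼ E)
  transC : ∀ {R T D} → Clos ℛ C (all R D) → ℛ ⊢ T ⊑* R → Trans ℛ T → Clos ℛ C (all T D)

data RoleExpr : Set₁ where
  role : Role → RoleExpr
  conj : (Role → Set) → RoleExpr

data BConcept (A : Set) : Set₁ where
  ⊤c ⊥c    : BConcept A
  atom     : A → BConcept A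
  natom    : A → BConcept A
  _⊓_ _⊔_  : BConcept A → BConcept A → BConcept A
  all ex   : RoleExpr → BConcept A → BConcept A
  atLeast atMost : ℕ → RoleExpr → BConcept A → BConcept A

_⊢_↑ : RBox → Role → RoleExpr
ℛ ⊢ R ↑ = conj (λ S → ℛ ⊢ R ⊑* S)

-- concept names of the translation: original names, and fresh names X_{R,D}
Name : Set
Name = ℕ ⊎ (Role × Concept)

X : Role → Concept → BConcept Name
X R D = atom (inj₂ (R , D))

tr : RBox → Concept → BConcept Name
tr ℛ ⊤c = ⊤c
tr ℛ ⊥c = ⊥c
tr ℛ (atom A) = atom (inj₁ A)
tr ℛ (natom A) = natom (inj₁ A)
tr ℛ (C ⊓ D) = tr ℛ C ⊓ tr ℛ D
tr ℛ (C ⊔ D) = tr ℛ C ⊔ tr ℛ D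
tr ℛ (all R D) = X R D
tr ℛ (ex R D) = natom (inj₂ (R , ∼ D))
tr ℛ (atLeast n R D) = atLeast n (ℛ ⊢ R ↑) (tr ℛ D)
tr ℛ (atMost n R D) = atMost n (ℛ ⊢ R ↑) (tr ℛ D)

record GCI (A : Set) : Set₁ where
  constructor _⊑_
  field
    lhs rhs : BConcept A

TBox : Set → Set₂
TBox A = GCI A → Set₁

-- 𝒯_C : X_{R,D} ≐ ∀R↑.D^tr (two GCIs), and X_{R,D} ⊑ ⨅_T ∀T↑.X_{T,D},
-- the latter conjunction given as one GCI per conjunct T
data 𝒯 (ℛ : RBox) (C : Concept) : TBox Name where
  defL : ∀ {R D} → Clos ℛ C (all R D) → 𝒯 ℛ C (X R D ⊑ all (ℛ ⊢ R ↑) (tr ℛ D))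
  defR : ∀ {R D} → Clos ℛ C (all R D) → 𝒯 ℛ C (all (ℛ ⊢ R ↑) (tr ℛ D) ⊑ X R D)
  prop : ∀ {R D T} → Clos ℛ C (all R D) → ℛ ⊢ T ⊑* R → Trans ℛ T →
         𝒯 ℛ C (X R D ⊑ all (ℛ ⊢ T ↑) (X T D))

record Interp (A : Set) : Set₁ where
  field
    Δ    : Set
    conc : A → Δ → Set
    rel  : ℕ → Δ → Δ → Set
open Interp public

module _ {A : Set} (I : Interp A) where

  ⟦_⟧r : Role → Δ I → Δ I → Set
  ⟦ rn n ⟧r x y  = rel I n x y
  ⟦ inv n ⟧r x y = rel I n y x

  ⟦_⟧e : RoleExpr → Δ I → Δ I → Set
  ⟦ role R ⟧e x y = ⟦ R ⟧r x y
  ⟦ conj P ⟧e x y = ∀ S → P S → ⟦ S ⟧r x y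

  AtLeast : ℕ → (Δ I → Set) → Set
  AtLeast n P = Σ (Fin n → Δ I) λ f → (∀ i j → f i ≡ f j → i ≡ j) × (∀ i → P (f i))

  AtMost : ℕ → (Δ I → Set) → Set
  AtMost n P = ¬ AtLeast (suc n) P

module _ (I : Interp ℕ) where
  ⟦_⟧ : Concept → Δ I → Set
  ⟦ ⊤c ⟧ x = ⊤
  ⟦ ⊥c ⟧ x = ⊥
  ⟦ atom A ⟧ x = conc I A x
  ⟦ natom A ⟧ x = ¬ conc I A x
  ⟦ C ⊓ D ⟧ x = ⟦ C ⟧ x × ⟦ D ⟧ x
  ⟦ C ⊔ D ⟧ x = ⟦ C ⟧ x ⊎ ⟦ D ⟧ x
  ⟦ all R D ⟧ x = ∀ y → ⟦_⟧r I R x y → ⟦ D ⟧ y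
  ⟦ ex R D ⟧ x = Σ (Δ I) λ y → ⟦_⟧r I R x y × ⟦ D ⟧ y
  ⟦ atLeast n R D ⟧ x = AtLeast I n (λ y → ⟦_⟧r I R x y × ⟦ D ⟧ y)
  ⟦ atMost n R D ⟧ x = AtMost I n (λ y → ⟦_⟧r I R x y × ⟦ D ⟧ y)

module _ {A : Set} (I : Interp A) where
  ⟦_⟧b : BConcept A → Δ I → Set
  ⟦ ⊤c ⟧b x = ⊤
  ⟦ ⊥c ⟧b x = ⊥
  ⟦ atom a ⟧b x = conc I a x
  ⟦ natom a ⟧b x = ¬ conc I a x
  ⟦ C ⊓ D ⟧b x = ⟦ C ⟧b x × ⟦ D ⟧b x
  ⟦ C ⊔ D ⟧b x = ⟦ C ⟧b x ⊎ ⟦ D ⟧b x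
  ⟦ all E D ⟧b x = ∀ y → ⟦_⟧e I E x y → ⟦ D ⟧b y
  ⟦ ex E D ⟧b x = Σ (Δ I) λ y → ⟦_⟧e I E x y × ⟦ D ⟧b y
  ⟦ atLeast n E D ⟧b x = AtLeast I n (λ y → ⟦_⟧e I E x y × ⟦ D ⟧b y)
  ⟦ atMost n E D ⟧b x = AtMost I n (λ y → ⟦_⟧e I E x y × ⟦ D ⟧b y)

ModelR : RBox → Interp ℕ → Set
ModelR ℛ I =
  (∀ {n} → n ∈ trans ℛ → ∀ x y z → rel I n x y → rel I n y z → rel I n x z) ×
  (∀ {R S} → (R , S) ∈ incl ℛ → ∀ x y → ⟦_⟧r I R x y → ⟦_⟧r I S x y)

SatR : RBox → Concept → Set₁
SatR ℛ C = Σ (Interp ℕ) λ I → ModelR ℛ I × Σ (Δ I) (⟦_⟧ I C)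

ModelT : {A : Set} → TBox A → Interp A → Set₁
ModelT 𝒯' I = ∀ {C D} → 𝒯' (C ⊑ D) → ∀ x → ⟦_⟧b I C x → ⟦ I ⟧b D x

SatT : {A : Set} → TBox A → BConcept A → Set₁
SatT {A} 𝒯' C = Σ (Interp A) λ I → ModelT 𝒯' I × Σ (Δ I) (⟦_⟧b I C)

-- Both directions compare C and C^tr in interpretations over one domain by an induction over
-- clos(C,ℛ), assuming only that simple roles S mean the same as S↑ and that each X_{R,D} means
-- ∀R.D. Given a model I of ℛ, reading X_{R,D} as ∀R.D makes both assumptions and all of 𝒯_C
-- hold. Given a model J of 𝒯_C, interpret a role R by R↑ together with the transitive closure
-- of T↑ for every transitive T ⊑* R: this satisfies ℛ, adds nothing to simple roles, and the
-- propagation axioms X_{R,D} ⊑ ∀T↑.X_{T,D} carry X_{R,D} along the added chains, so X_{R,D}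
-- still means ∀R.D. Excluded middle enters because ∃R.D is translated as ¬X_{R,∼D}.
module Submission where

open import Defs
open import Level using (0ℓ)
open import Axiom.ExcludedMiddle using (ExcludedMiddle)
open import Axiom.DoubleNegationElimination using (em⇒dne)
open import Function.Base using (_∘_)
open import Function.Bundles using (_⇔_; mk⇔; Equivalence)
open import Function.Construct.Identity using (⇔-id)
open import Function.Construct.Symmetry using (⇔-sym)
open import Function.Construct.Composition using (_⇔-∘_)
open import Function.Related.TypeIsomorphisms using (¬-cong-⇔)
open import Data.Product.Function.NonDependent.Propositional using (_×-⇔_)
open import Data.Sum.Function.Propositional using (_⊎-⇔_)
open import Data.Nat using (ℕ; zero; suc; _+_; _≤_; _<_; s≤s; z≤n)
open import Data.Nat.Properties using (≤-refl; ≤-<-trans; m≤m+n; m≤n+m; +-mono-≤)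
open import Data.Nat.Induction using (<-wellFounded)
open import Data.Product using (∃; _×_; _,_; proj₁; proj₂)
open import Data.Sum as Sum using (_⊎_; inj₁; inj₂)
open import Data.Empty using (⊥-elim)
open import Data.Unit using (tt)
open import Relation.Nullary using (¬_; yes; no)
open import Relation.Nullary.Negation.Core using (_¬-⊎_)
open import Relation.Binary.PropositionalEquality using (_≡_; refl; subst)
open import Relation.Binary.Construct.Closure.Transitive using (Plus; [_]; _∼⁺⟨_⟩_; map)
import Relation.Binary.Construct.On as On
open import Induction.WellFounded using (WellFounded; module All)

open Equivalence using (to; from)

private
  variable
    R S T : Role
    D E : Concept

Inv-involutive : ∀ R → Inv (Inv R) ≡ R
Inv-involutive (rn n) = refl
Inv-involutive (inv n) = refl

Trans-Inv : ∀ {ℛ} R → Trans ℛ R → Trans ℛ (Inv R)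
Trans-Inv (rn n) t = t
Trans-Inv (inv n) t = t

module _ {ℛ : RBox} where

  ⊑*-trans : ℛ ⊢ R ⊑* S → ℛ ⊢ S ⊑* T → ℛ ⊢ R ⊑* T
  ⊑*-trans refl* S⊑T = S⊑T
  ⊑*-trans (step p R⊑S) S⊑T = step p (⊑*-trans R⊑S S⊑T)
  ⊑*-trans (stepInv p R⊑S) S⊑T = stepInv p (⊑*-trans R⊑S S⊑T)

  ⊑*-Inv : ℛ ⊢ R ⊑* S → ℛ ⊢ Inv R ⊑* Inv S
  ⊑*-Inv refl* = refl*
  ⊑*-Inv (step p q) = stepInv p (⊑*-Inv q)
  ⊑*-Inv (stepInv {R} {S} {T} p q) rewrite Inv-involutive R =
    step p (subst (λ S′ → ℛ ⊢ S′ ⊑* Inv T) (Inv-involutive S) (⊑*-Inv q))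

Plus-reverse : {A : Set} {P Q : A → A → Set} → (∀ {x y} → P x y → Q y x) →
               ∀ {x y} → Plus P x y → Plus Q y x
Plus-reverse f [ p ] = [ f p ]
Plus-reverse f (_ ∼⁺⟨ p ⟩ q) = _ ∼⁺⟨ Plus-reverse f q ⟩ Plus-reverse f p

module _ {A : Set} (I : Interp A) where

  ⟦Inv⟧r⇔ : ∀ R {x y} → ⟦_⟧r I (Inv R) x y ⇔ ⟦_⟧r I R y x
  ⟦Inv⟧r⇔ (rn n) = ⇔-id _
  ⟦Inv⟧r⇔ (inv n) = ⇔-id _

  AtLeast-cong : ∀ {n} {P Q : Δ I → Set} → (∀ z → P z ⇔ Q z) → AtLeast I n P ⇔ AtLeast I n Q
  AtLeast-cong P⇔Q = mk⇔
    (λ (f , f-injective , f∈P) → f , f-injective , λ i → to (P⇔Q (f i)) (f∈P i))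
    (λ (f , f-injective , f∈Q) → f , f-injective , λ i → from (P⇔Q (f i)) (f∈Q i))

module _ {ℛ : RBox} {I : Interp ℕ} (I⊨ℛ : ModelR ℛ I) where

  ⊑*-sound : ∀ {x y} → ℛ ⊢ R ⊑* S → ⟦_⟧r I R x y → ⟦_⟧r I S x y
  ⊑*-sound refl* xRy = xRy
  ⊑*-sound (step p q) xRy = ⊑*-sound q (proj₂ I⊨ℛ p _ _ xRy)
  ⊑*-sound (stepInv {R} {S} p q) xRy =
    ⊑*-sound q (from (⟦Inv⟧r⇔ I S) (proj₂ I⊨ℛ p _ _ (to (⟦Inv⟧r⇔ I R) xRy)))

  Trans-sound : ∀ {x y z} → Trans ℛ T → ⟦_⟧r I T x y → ⟦_⟧r I T y z → ⟦_⟧r I T x z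
  Trans-sound {rn n} t xTy yTz = proj₁ I⊨ℛ t _ _ _ xTy yTz
  Trans-sound {inv n} t xTy yTz = proj₁ I⊨ℛ t _ _ _ yTz xTy

¬⊎⇔¬×¬ : {P Q : Set} → (¬ (P ⊎ Q)) ⇔ (¬ P × ¬ Q)
¬⊎⇔¬×¬ = mk⇔ (λ ¬p⊎q → ¬p⊎q ∘ inj₁ , ¬p⊎q ∘ inj₂) (λ (¬p , ¬q) → ¬p ¬-⊎ ¬q)

module _ (em : ExcludedMiddle 0ℓ) where

  private
    dne : {P : Set} → ¬ ¬ P → P
    dne = em⇒dne em

  ¬¬⇔ : {P : Set} → (¬ ¬ P) ⇔ P
  ¬¬⇔ = mk⇔ dne (λ p ¬p → ¬p p)

  ¬×⇔¬⊎¬ : {P Q : Set} → (¬ (P × Q)) ⇔ (¬ P ⊎ ¬ Q)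
  ¬×⇔¬⊎¬ {P} = mk⇔ split Sum.[ (λ ¬p (p , _) → ¬p p) , (λ ¬q (_ , q) → ¬q q) ]
    where
    split : ∀ {Q} → ¬ (P × Q) → ¬ P ⊎ ¬ Q
    split ¬p×q with em {P}
    ... | yes p = inj₂ (λ q → ¬p×q (p , q))
    ... | no ¬p = inj₁ ¬p

  ¬∀⇒∃¬ : {A : Set} (P Q : A → Set) → ¬ (∀ x → P x → Q x) → ∃ λ x → P x × ¬ Q x
  ¬∀⇒∃¬ P Q ¬∀ = dne λ ¬∃ → ¬∀ λ x p → dne λ ¬q → ¬∃ (x , p , ¬q)

  ⟦∼⟧⇔¬ : (I : Interp ℕ) → ∀ D {y} → ⟦_⟧ I (∼ D) y ⇔ (¬ ⟦_⟧ I D y)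
  ⟦∼⟧⇔¬ I ⊤c = mk⇔ (λ ()) (λ ¬⊤ → ¬⊤ tt)
  ⟦∼⟧⇔¬ I ⊥c = mk⇔ (λ _ ()) (λ _ → tt)
  ⟦∼⟧⇔¬ I (atom A) = ⇔-id _
  ⟦∼⟧⇔¬ I (natom A) = ⇔-sym ¬¬⇔
  ⟦∼⟧⇔¬ I (C ⊓ D) = ⇔-sym ¬×⇔¬⊎¬ ⇔-∘ (⟦∼⟧⇔¬ I C ⊎-⇔ ⟦∼⟧⇔¬ I D)
  ⟦∼⟧⇔¬ I (C ⊔ D) = ⇔-sym ¬⊎⇔¬×¬ ⇔-∘ (⟦∼⟧⇔¬ I C ×-⇔ ⟦∼⟧⇔¬ I D)
  ⟦∼⟧⇔¬ I (all R D) {y} = mk⇔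
    (λ (z , yRz , z∈∼D) y∈∀ → to (⟦∼⟧⇔¬ I D) z∈∼D (y∈∀ z yRz))
    (λ y∉∀ → let (z , yRz , z∉D) = ¬∀⇒∃¬ (⟦_⟧r I R y) (⟦_⟧ I D) y∉∀
             in z , yRz , from (⟦∼⟧⇔¬ I D) z∉D)
  ⟦∼⟧⇔¬ I (ex R D) = mk⇔
    (λ y∈∀ (z , yRz , z∈D) → to (⟦∼⟧⇔¬ I D) (y∈∀ z yRz) z∈D)
    (λ y∉∃ z yRz → from (⟦∼⟧⇔¬ I D) λ z∈D → y∉∃ (z , yRz , z∈D))
  ⟦∼⟧⇔¬ I (atLeast zero R D) = mk⇔ (λ ()) (λ ¬≥0 → ¬≥0 ((λ ()) , (λ ()) , (λ ())))
  ⟦∼⟧⇔¬ I (atLeast (suc n) R D) = ⇔-id _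
  ⟦∼⟧⇔¬ I (atMost n R D) = ⇔-sym ¬¬⇔

  ¬⟦∼⟧⇔⟦⟧ : (I : Interp ℕ) → ∀ D {y} → (¬ ⟦_⟧ I (∼ D) y) ⇔ ⟦_⟧ I D y
  ¬⟦∼⟧⇔⟦⟧ I D = ¬¬⇔ ⇔-∘ ¬-cong-⇔ (⟦∼⟧⇔¬ I D)

size : Concept → ℕ
size ⊤c = 1
size ⊥c = 1
size (atom _) = 1
size (natom _) = 1
size (C ⊓ D) = suc (size C + size D)
size (C ⊔ D) = suc (size C + size D)
size (all R D) = suc (size D)
size (ex R D) = suc (size D)
size (atLeast n R D) = suc (size D)
size (atMost n R D) = suc (size D)

size-∼ : ∀ D → size (∼ D) ≤ size D
size-∼ ⊤c = ≤-refl
size-∼ ⊥c = ≤-refl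
size-∼ (atom _) = ≤-refl
size-∼ (natom _) = ≤-refl
size-∼ (C ⊓ D) = s≤s (+-mono-≤ (size-∼ C) (size-∼ D))
size-∼ (C ⊔ D) = s≤s (+-mono-≤ (size-∼ C) (size-∼ D))
size-∼ (all R D) = s≤s (size-∼ D)
size-∼ (ex R D) = s≤s (size-∼ D)
size-∼ (atLeast zero R D) = s≤s z≤n
size-∼ (atLeast (suc n) R D) = ≤-refl
size-∼ (atMost n R D) = ≤-refl

_⊏_ : Concept → Concept → Set
D ⊏ E = size D < size E

⊏-wellFounded : WellFounded _⊏_
⊏-wellFounded = On.wellFounded size <-wellFounded

◁⇒⊏ : D ◁ E → D ⊏ E
◁⇒⊏ (⊓l {C} {D}) = s≤s (m≤m+n (size C) (size D))
◁⇒⊏ (⊓r {C} {D}) = s≤s (m≤n+m (size D) (size C))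
◁⇒⊏ (⊔l {C} {D}) = s≤s (m≤m+n (size C) (size D))
◁⇒⊏ (⊔r {C} {D}) = s≤s (m≤n+m (size D) (size C))
◁⇒⊏ ∀s = ≤-refl
◁⇒⊏ ∃s = ≤-refl
◁⇒⊏ ≥s = ≤-refl
◁⇒⊏ ≤s = ≤-refl

∼◁⇒⊏ : D ◁ E → ∼ D ⊏ E
∼◁⇒⊏ {D} D◁E = ≤-<-trans (size-∼ D) (◁⇒⊏ D◁E)

module _ {ℛ : RBox} where

  SHIQConcept-◁ : D ◁ E → SHIQConcept ℛ E → SHIQConcept ℛ D
  SHIQConcept-◁ ⊓l (⊓w C D) = C
  SHIQConcept-◁ ⊓r (⊓w C D) = D
  SHIQConcept-◁ ⊔l (⊔w C D) = C
  SHIQConcept-◁ ⊔r (⊔w C D) = D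
  SHIQConcept-◁ ∀s (allw D) = D
  SHIQConcept-◁ ∃s (exw D) = D
  SHIQConcept-◁ ≥s (atLeastw _ D) = D
  SHIQConcept-◁ ≤s (atMostw _ D) = D

  SHIQConcept-∼ : SHIQConcept ℛ E → SHIQConcept ℛ (∼ E)
  SHIQConcept-∼ ⊤w = ⊥w
  SHIQConcept-∼ ⊥w = ⊤w
  SHIQConcept-∼ atomw = natomw
  SHIQConcept-∼ natomw = atomw
  SHIQConcept-∼ (⊓w C D) = ⊔w (SHIQConcept-∼ C) (SHIQConcept-∼ D)
  SHIQConcept-∼ (⊔w C D) = ⊓w (SHIQConcept-∼ C) (SHIQConcept-∼ D)
  SHIQConcept-∼ (allw D) = exw (SHIQConcept-∼ D)
  SHIQConcept-∼ (exw D) = allw (SHIQConcept-∼ D)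
  SHIQConcept-∼ (atLeastw {zero} _ _) = ⊥w
  SHIQConcept-∼ (atLeastw {suc n} S-simple D) = atMostw S-simple D
  SHIQConcept-∼ (atMostw S-simple D) = atLeastw S-simple D

  SHIQConcept-Clos : ∀ {C} → SHIQConcept ℛ C → Clos ℛ C E → SHIQConcept ℛ E
  SHIQConcept-Clos C-SHIQ base = C-SHIQ
  SHIQConcept-Clos C-SHIQ (sub c D◁E) = SHIQConcept-◁ D◁E (SHIQConcept-Clos C-SHIQ c)
  SHIQConcept-Clos C-SHIQ (neg c) = SHIQConcept-∼ (SHIQConcept-Clos C-SHIQ c)
  SHIQConcept-Clos C-SHIQ (transC c _ _) with SHIQConcept-Clos C-SHIQ c
  ... | allw D = allw D

reduct : (J : Interp Name) → (ℕ → Δ J → Δ J → Set) → Interp ℕ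
reduct J r = record { Δ = Δ J ; conc = conc J ∘ inj₁ ; rel = r }

⟦⟧r-reduct : (J : Interp Name) → ∀ R {x y} → ⟦_⟧r (reduct J (rel J)) R x y ⇔ ⟦_⟧r J R x y
⟦⟧r-reduct J (rn n) = ⇔-id _
⟦⟧r-reduct J (inv n) = ⇔-id _

module Faithfulness (em : ExcludedMiddle 0ℓ) (ℛ : RBox) {C : Concept} (C-SHIQ : SHIQConcept ℛ C)
                    (J : Interp Name) (r : ℕ → Δ J → Δ J → Set) where

  private
    I : Interp ℕ
    I = reduct J r

  Faithful : Concept → Set
  Faithful E = ∀ y → ⟦_⟧b J (tr ℛ E) y ⇔ ⟦_⟧ I E y

  module _ (↑-faithful : ∀ {S} → Simple ℛ S → ∀ {x y} → ⟦_⟧e J (ℛ ⊢ S ↑) x y ⇔ ⟦_⟧r I S x y)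
           (X-faithful : ∀ {R D} → Clos ℛ C (all R D) → Faithful D →
                         ∀ y → ⟦_⟧b J (X R D) y ⇔ ⟦_⟧ I (all R D) y)
    where

    faithful-step : ∀ E → Clos ℛ C E →
                    (∀ {D} → D ◁ E → Faithful D) → (∀ {D} → D ◁ E → Faithful (∼ D)) → Faithful E
    faithful-step ⊤c _ _ _ _ = ⇔-id _
    faithful-step ⊥c _ _ _ _ = ⇔-id _
    faithful-step (atom A) _ _ _ _ = ⇔-id _
    faithful-step (natom A) _ _ _ _ = ⇔-id _
    faithful-step (E₁ ⊓ E₂) _ ih _ y = ih ⊓l y ×-⇔ ih ⊓r y
    faithful-step (E₁ ⊔ E₂) _ ih _ y = ih ⊔l y ⊎-⇔ ih ⊔r y
    faithful-step (all R D) c ih _ = X-faithful c (ih ∀s)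
    faithful-step (ex R D) c _ ih∼ y =
      ¬⟦∼⟧⇔⟦⟧ em I (ex R D) ⇔-∘ ¬-cong-⇔ (X-faithful (neg c) (ih∼ ∃s) y)
    faithful-step (atLeast n R D) c ih _ y with SHIQConcept-Clos C-SHIQ c
    ... | atLeastw R-simple _ = AtLeast-cong I λ z → ↑-faithful R-simple {y} {z} ×-⇔ ih ≥s z
    faithful-step (atMost n R D) c ih _ y with SHIQConcept-Clos C-SHIQ c
    ... | atMostw R-simple _ = ¬-cong-⇔ (AtLeast-cong I λ z → ↑-faithful R-simple {y} {z} ×-⇔ ih ≤s z)

    faithful-on-clos : Clos ℛ C E → Faithful E
    faithful-on-clos {E} = All.wfRec ⊏-wellFounded 0ℓ (λ E → Clos ℛ C E → Faithful E) faithful-rec E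
      where
      faithful-rec : ∀ E → (∀ {D} → D ⊏ E → Clos ℛ C D → Faithful D) → Clos ℛ C E → Faithful E
      faithful-rec E ih c = faithful-step E c (λ D◁E → ih (◁⇒⊏ D◁E) (sub c D◁E))
                                              (λ D◁E → ih (∼◁⇒⊏ D◁E) (neg (sub c D◁E)))

expansion : Interp ℕ → Interp Name
expansion I = record
  { Δ = Δ I ; conc = Sum.[ conc I , (λ (R , D) → ⟦_⟧ I (all R D)) ] ; rel = rel I }

module Forward (em : ExcludedMiddle 0ℓ) (ℛ : RBox) {C : Concept} (C-SHIQ : SHIQConcept ℛ C)
               (I : Interp ℕ) (I⊨ℛ : ModelR ℛ I) where

  private
    J : Interp Name
    J = expansion I

  open Faithfulness em ℛ C-SHIQ J (rel I) using (Faithful; faithful-on-clos)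

  ↑-faithful : ∀ {x y} → ⟦_⟧e J (ℛ ⊢ R ↑) x y ⇔ ⟦_⟧r I R x y
  ↑-faithful {R} = mk⇔
    (λ xR↑y → from (⟦⟧r-reduct J R) (xR↑y R refl*))
    (λ xRy S R⊑S → to (⟦⟧r-reduct J S) (⊑*-sound I⊨ℛ R⊑S xRy))

  tr-faithful : Clos ℛ C E → Faithful E
  tr-faithful = faithful-on-clos (λ _ → ↑-faithful) (λ _ _ _ → ⇔-id _)

  expansion⊨𝒯 : ModelT (𝒯 ℛ C) J
  expansion⊨𝒯 (defL c) x x∈∀ y xR↑y = from (tr-faithful (sub c ∀s) y) (x∈∀ y (to ↑-faithful xR↑y))
  expansion⊨𝒯 (defR c) x x∈∀↑ y xRy = to (tr-faithful (sub c ∀s) y) (x∈∀↑ y (from ↑-faithful xRy))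
  expansion⊨𝒯 (prop c T⊑R T-trans) x x∈∀ y xT↑y z yTz =
    x∈∀ z (⊑*-sound I⊨ℛ T⊑R (Trans-sound I⊨ℛ T-trans (to ↑-faithful xT↑y) yTz))

module Backward (em : ExcludedMiddle 0ℓ) (ℛ : RBox) {C : Concept} (C-SHIQ : SHIQConcept ℛ C)
                (J : Interp Name) (J⊨𝒯 : ModelT (𝒯 ℛ C) J) where

  ⟦_⟧↑ : Role → Δ J → Δ J → Set
  ⟦ R ⟧↑ = ⟦_⟧e J (ℛ ⊢ R ↑)

  ⟦_⟧⁺ : Role → Δ J → Δ J → Set
  ⟦ R ⟧⁺ x y = ⟦ R ⟧↑ x y ⊎ ∃ λ T → ℛ ⊢ T ⊑* R × Trans ℛ T × Plus ⟦ T ⟧↑ x y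

  closure : Interp ℕ
  closure = reduct J (λ n → ⟦ rn n ⟧⁺)

  open Faithfulness em ℛ C-SHIQ J (λ n → ⟦ rn n ⟧⁺) using (Faithful; faithful-on-clos)

  ↑-mono : ∀ {x y} → ℛ ⊢ T ⊑* R → ⟦ T ⟧↑ x y → ⟦ R ⟧↑ x y
  ↑-mono T⊑R xT↑y S R⊑S = xT↑y S (⊑*-trans T⊑R R⊑S)

  ↑-Inv : ∀ {x y} → ⟦ R ⟧↑ x y → ⟦ Inv R ⟧↑ y x
  ↑-Inv {R} xR↑y S InvR⊑S =
    to (⟦Inv⟧r⇔ J S) (xR↑y (Inv S) (subst (λ R′ → ℛ ⊢ R′ ⊑* Inv S) (Inv-involutive R) (⊑*-Inv InvR⊑S)))

  ⁺-mono : ∀ {x y} → ℛ ⊢ T ⊑* R → ⟦ T ⟧⁺ x y → ⟦ R ⟧⁺ x y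
  ⁺-mono T⊑R (inj₁ xT↑y) = inj₁ (↑-mono T⊑R xT↑y)
  ⁺-mono T⊑R (inj₂ (T′ , T′⊑T , T′-trans , chain)) = inj₂ (T′ , ⊑*-trans T′⊑T T⊑R , T′-trans , chain)

  ⁺-Inv : ∀ {x y} → ⟦ R ⟧⁺ x y → ⟦ Inv R ⟧⁺ y x
  ⁺-Inv (inj₁ xR↑y) = inj₁ (↑-Inv xR↑y)
  ⁺-Inv (inj₂ (T , T⊑R , T-trans , chain)) =
    inj₂ (Inv T , ⊑*-Inv T⊑R , Trans-Inv T T-trans , Plus-reverse ↑-Inv chain)

  ⁺⇒Plus-↑ : ∀ {x y} → ⟦ R ⟧⁺ x y → Plus ⟦ R ⟧↑ x y
  ⁺⇒Plus-↑ (inj₁ xR↑y) = [ xR↑y ]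
  ⁺⇒Plus-↑ (inj₂ (T , T⊑R , _ , chain)) = map (↑-mono T⊑R) chain

  ⁺⇔↑-simple : ∀ {x y} → Simple ℛ S → ⟦ S ⟧⁺ x y ⇔ ⟦ S ⟧↑ x y
  ⁺⇔↑-simple {S} S-simple = mk⇔ Sum.[ (λ xS↑y → xS↑y) , non-simple ] inj₁
    where
    non-simple : ∀ {x y} → ∃ (λ T → ℛ ⊢ T ⊑* S × Trans ℛ T × Plus ⟦ T ⟧↑ x y) → ⟦ S ⟧↑ x y
    non-simple (T , T⊑S , T-trans , _) = ⊥-elim (S-simple T T⊑S T-trans)

  ⟦⟧r⇔⁺ : ∀ R {x y} → ⟦_⟧r closure R x y ⇔ ⟦ R ⟧⁺ x y
  ⟦⟧r⇔⁺ (rn n) = ⇔-id _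
  ⟦⟧r⇔⁺ (inv n) = mk⇔ ⁺-Inv ⁺-Inv

  closure⊨ℛ : ModelR ℛ closure
  closure⊨ℛ =
    (λ {n} n-trans x y z xy yz → inj₂ (rn n , refl* , n-trans , (x ∼⁺⟨ ⁺⇒Plus-↑ xy ⟩ ⁺⇒Plus-↑ yz))) ,
    (λ {R} {S} R⊑S x y xRy → from (⟦⟧r⇔⁺ S) (⁺-mono (step R⊑S refl*) (to (⟦⟧r⇔⁺ R) xRy)))

  X-propagates : ∀ {x y} → Clos ℛ C (all R D) → ℛ ⊢ T ⊑* R → Trans ℛ T →
                 ⟦_⟧b J (X R D) x → Plus ⟦ T ⟧↑ x y → ⟦_⟧b J (X T D) y
  X-propagates c T⊑R T-trans x∈X [ xT↑y ] = J⊨𝒯 (prop c T⊑R T-trans) _ x∈X _ xT↑y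
  X-propagates c T⊑R T-trans x∈X (_ ∼⁺⟨ x⁺w ⟩ w⁺y) =
    X-propagates (transC c T⊑R T-trans) refl* T-trans (X-propagates c T⊑R T-trans x∈X x⁺w) w⁺y

  X-along-Plus : ∀ {x y} → Clos ℛ C (all R D) → ℛ ⊢ T ⊑* R → Trans ℛ T →
                 ⟦_⟧b J (X R D) x → Plus ⟦ T ⟧↑ x y → ⟦_⟧b J (tr ℛ D) y
  X-along-Plus c T⊑R T-trans x∈X [ xT↑y ] = J⊨𝒯 (defL c) _ x∈X _ (↑-mono T⊑R xT↑y)
  X-along-Plus c T⊑R T-trans x∈X (_ ∼⁺⟨ x⁺w ⟩ w⁺y) =
    X-along-Plus (transC c T⊑R T-trans) refl* T-trans (X-propagates c T⊑R T-trans x∈X x⁺w) w⁺y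

  X-faithful : Clos ℛ C (all R D) → Faithful D → ∀ x → ⟦_⟧b J (X R D) x ⇔ ⟦_⟧ closure (all R D) x
  X-faithful {R} {D} c D-faithful x = mk⇔ sound complete
    where
    sound : ⟦_⟧b J (X R D) x → ⟦_⟧ closure (all R D) x
    sound x∈X y xRy with to (⟦⟧r⇔⁺ R) xRy
    ... | inj₁ xR↑y = to (D-faithful y) (J⊨𝒯 (defL c) x x∈X y xR↑y)
    ... | inj₂ (T , T⊑R , T-trans , chain) = to (D-faithful y) (X-along-Plus c T⊑R T-trans x∈X chain)

    complete : ⟦_⟧ closure (all R D) x → ⟦_⟧b J (X R D) x
    complete x∈∀ = J⊨𝒯 (defR c) x λ y xR↑y → from (D-faithful y) (x∈∀ y (from (⟦⟧r⇔⁺ R) (inj₁ xR↑y)))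

  tr-faithful : Clos ℛ C E → Faithful E
  tr-faithful = faithful-on-clos (λ S-simple → ⇔-sym (⁺⇔↑-simple S-simple ⇔-∘ ⟦⟧r⇔⁺ _)) X-faithful

mainTheorem19 : ExcludedMiddle 0ℓ → (ℛ : RBox) → CycleFree ℛ →
    (C : Concept) → SHIQConcept ℛ C →
    SatR ℛ C ⇔ SatT (𝒯 ℛ C) (tr ℛ C)
mainTheorem19 em ℛ _ C C-SHIQ = mk⇔ satR⇒satT satT⇒satR
  where
  satR⇒satT : SatR ℛ C → SatT (𝒯 ℛ C) (tr ℛ C)
  satR⇒satT (I , I⊨ℛ , x , x∈C) = expansion I , expansion⊨𝒯 , x , from (tr-faithful base x) x∈C
    where open Forward em ℛ C-SHIQ I I⊨ℛ

  satT⇒satR : SatT (𝒯 ℛ C) (tr ℛ C) → SatR ℛ C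
  satT⇒satR (J , J⊨𝒯 , x , x∈trC) = closure , closure⊨ℛ , x , to (tr-faithful base x) x∈trC
    where open Backward em ℛ C-SHIQ J J⊨𝒯
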